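{- For every integer $k\geq 2$, every finite digraph $D$ is $\frac{1}{k}$-majority $2k$-choosable: for any assignment to each vertex $v$ of a list $L(v)$ of $2k$ colours, there is a colouring $c$ with $c(v)\in L(v)$ for every vertex $v$, such that for every vertex $v$ the number of out-neighbours $w$ of $v$ with $c(w)=c(v)$ is at most $d^{+}(v)/k$, where $d^{+}(v)$ is the out-degree of $v$.
   Context: A $\frac{1}{k}$-majority colouring of a digraph is a colouring of its vertices such that each vertex receives the same colour as at most a $1/k$ proportion of its out-neighbours. A digraph is $\frac{1}{k}$-majority $m$-choosable if for any assignment of lists of $m$ colours to the vertices there is a $\frac{1}{k}$-majority colouring in which each vertex gets a colour from its list. -}

module Defs where

open import Data.Nat using (ℕ; _*_; _≤_)
open import Data.Nat.Properties using () renaming (_≟_ to _≟ℕ_)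
open import Data.Fin using (Fin)
open import Data.List using (List; length; filter)
open import Data.List.Membership.Propositional using (_∈_)
open import Data.List.Relation.Unary.Unique.Propositional using (Unique)
open import Data.Product using (_×_; Σ)
open import Data.Fin.Base using ()
open import Data.List using (allFin)
open import Relation.Nullary using (¬_; _×-dec_)
open import Relation.Binary using (Rel; Decidable)
open import Relation.Binary.PropositionalEquality using (_≡_)
open import Level using (0ℓ)

-- A finite digraph on vertex set Fin n: a decidable, loopless arc relation
-- (arc v w means v → w). No multiple arcs, since arcs form a relation.
record Digraph (n : ℕ) : Set₁ where
  field
    Arc   : Rel (Fin n) 0ℓ
    arc?  : Decidable Arc
    loopless : ∀ v → ¬ Arc v v

open Digraph public

Colouring : ℕ → Set
Colouring n = Fin n → ℕ

outdeg : ∀ {n} → Digraph n → Fin n → ℕ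
outdeg D v = length (filter (arc? D v) (allFin _))

sameOut : ∀ {n} → Digraph n → Colouring n → Fin n → ℕ
sameOut D c v = length (filter (λ w → arc? D v w ×-dec (c w ≟ℕ c v)) (allFin _))

-- c is a 1/k-majority colouring: for each v, sameOut ≤ d⁺(v)/k, i.e. k * sameOut ≤ d⁺(v)
IsMajorityColouring : ∀ {n} → ℕ → Digraph n → Colouring n → Set
IsMajorityColouring k D c = ∀ v → k * sameOut D c v ≤ outdeg D v

IsListAssignment : ∀ {n} → ℕ → (Fin n → List ℕ) → Set
IsListAssignment m L = ∀ v → Unique (L v) × length (L v) ≡ m

MajorityChoosable : ℕ → ℕ → ∀ {n} → Digraph n → Set
MajorityChoosable k m {n} D = ∀ (L : Fin n → List ℕ) → IsListAssignment m L →
  Σ (Colouring n) λ c → (∀ v → c v ∈ L v) × IsMajorityColouring k D c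

-- Fix positive weights y with Σ_{u→v} y(u) < (d⁺(v)+1)·y(v) for every v; they are found by
-- repeatedly raising by one the weight of a vertex violating this, which keeps the total weight
-- at most Σ_v (d⁺(v)+1). Measure a list colouring c by the potential Σ_u y(u)·#{u→w : c(w) = c(u)}.
-- The part of the potential that depends on the colour b of a vertex v is its local cost: y(v)
-- times the number of out-neighbours of v coloured b, plus the total weight of the in-neighbours
-- of v coloured b. Summed over the 2k colours of L(v) these costs are at most
-- y(v)·d⁺(v) + Σ_{u→v} y(u) < 2(d⁺(v)+1)·y(v). If v has more than d⁺(v)/k out-neighbours of its
-- own colour, this is at most 2k times the cost of the current colour of v, so some colour of
-- L(v) is strictly cheaper and recolouring v lowers the potential. A colouring of minimal
-- potential is therefore a 1/k-majority colouring.
module Submission where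

open import Defs

open import Algebra.Properties.Semiring.Sum using ()
open import Data.Fin using (Fin; zero; suc; _≟_)
open import Data.Fin.Properties using (all?; ¬∀⟶∃¬; suc-injective; punchInᵢ≢i)
open import Data.List using (List; _∷_; length; filter; tabulate; allFin; lookup)
open import Data.List.Membership.Propositional using (_∈_)
open import Data.List.Membership.Propositional.Properties using (∈-lookup)
open import Data.List.Relation.Unary.All as All using ()
open import Data.List.Relation.Unary.AllPairs using (_∷_)
open import Data.List.Relation.Unary.Any using (here)
open import Data.List.Relation.Unary.Unique.Propositional using (Unique)
open import Data.Nat using (ℕ; zero; suc; _+_; _*_; _∸_; _≤_; _<_; _≤?_; _<?_; z≤n; s≤s; z<s)
  renaming (_≟_ to _≟ℕ_)
open import Data.Nat.Induction using (<-wellFounded)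
open import Data.Nat.Properties
  using ( +-*-semiring; +-assoc; +-suc; +-identityʳ; *-assoc; *-comm; *-suc; *-zeroʳ; *-identityʳ
        ; ≤-reflexive; ≤-trans; <-trans; ≤-<-trans; n≤1+n; m≤n+m; ≮⇒≥; ≰⇒>
        ; +-mono-≤; +-monoˡ-≤; +-monoʳ-≤; +-monoˡ-<; +-monoʳ-<; *-monoˡ-≤; *-monoʳ-≤; ∸-monoʳ-<
        ; +-cancelʳ-≡; +-cancelˡ-<; +-cancelʳ-<; +-cancelʳ-≤; module ≤-Reasoning )
open import Data.Nat.Tactic.RingSolver using (solve-∀)
open import Data.Product using (Σ; ∃; _×_; _,_; proj₁; proj₂)
open import Data.Vec.Functional using (removeAt; updateAt)
open import Data.Vec.Functional.Properties using (updateAt-updates; updateAt-minimal)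
open import Function using (_∘_; id)
open import Function.Definitions using (Injective)
open import Induction.WellFounded using (Acc; acc)
open import Relation.Binary.PropositionalEquality
  using (_≡_; _≢_; refl; sym; trans; cong; cong₂; subst; module ≡-Reasoning)
open import Relation.Nullary using (Dec; yes; no; ¬_; _×-dec_; contradiction)
open import Relation.Unary using (Decidable)

open Algebra.Properties.Semiring.Sum +-*-semiring
  using (sum; sum-syntax; sum-cong-≗; sum-remove; sum-replicate-zero; ∑-distrib-+; ∑-comm; *-distribˡ-sum)

find-by-descent : {A : Set} (Inv Goal : A → Set) (μ : A → ℕ) → Decidable Goal →
  (∀ a → Inv a → ¬ Goal a → Σ A λ a′ → Inv a′ × μ a′ < μ a) →
  ∀ a → Inv a → Σ A λ a → Inv a × Goal a
find-by-descent {A} Inv Goal μ goal? improve a = go a (<-wellFounded (μ a))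
  where
  go : ∀ a → Acc _<_ (μ a) → Inv a → Σ A λ a → Inv a × Goal a
  go a (acc rs) inv with goal? a
  ... | yes goal = a , inv , goal
  ... | no ¬goal with a′ , inv′ , μa′<μa ← improve a inv ¬goal = go a′ (rs μa′<μa) inv′

∑-mono-≤ : ∀ {n} {f g : Fin n → ℕ} → (∀ i → f i ≤ g i) → sum f ≤ sum g
∑-mono-≤ {zero}  f≤g = z≤n
∑-mono-≤ {suc n} f≤g = +-mono-≤ (f≤g zero) (∑-mono-≤ (f≤g ∘ suc))

∑<*⇒∃< : ∀ {n} (f : Fin n → ℕ) x → sum f < n * x → ∃ λ i → f i < x
∑<*⇒∃< {suc n} f x ∑f<nx with f zero <? x
... | yes f₀<x = zero , f₀<x
... | no  f₀≮x
  with i , fᵢ<x ← ∑<*⇒∃< (f ∘ suc) x (+-cancelˡ-< x _ _ (≤-<-trans (+-monoˡ-≤ _ (≮⇒≥ f₀≮x)) ∑f<nx))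
  = suc i , fᵢ<x

∑-exchange : ∀ {n} {f g : Fin n → ℕ} (j : Fin n) → (∀ i → i ≢ j → f i ≡ g i) →
  sum f + g j ≡ sum g + f j
∑-exchange {suc n} {f} {g} j f≡g = begin
  sum f + g j                     ≡⟨ cong (_+ g j) (sum-remove {i = j} f) ⟩
  f j + sum (removeAt f j) + g j  ≡⟨ cong (λ s → f j + s + g j) (sum-cong-≗ λ i → f≡g _ (punchInᵢ≢i j i)) ⟩
  f j + sum (removeAt g j) + g j  ≡⟨ swap-outer (f j) (sum (removeAt g j)) (g j) ⟩
  g j + sum (removeAt g j) + f j  ≡⟨ cong (_+ f j) (sum-remove {i = j} g) ⟨
  sum g + f j                     ∎
  where
  open ≡-Reasoning
  swap-outer : ∀ x s z → x + s + z ≡ z + s + x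
  swap-outer = solve-∀

∑-cong-off : ∀ {n} {f g : Fin n → ℕ} (j : Fin n) → (∀ i → i ≢ j → f i ≡ g i) → f j ≡ g j → sum f ≡ sum g
∑-cong-off {f = f} {g} j f≡g fⱼ≡gⱼ =
  +-cancelʳ-≡ (g j) (sum f) (sum g) (trans (∑-exchange j f≡g) (cong (sum g +_) fⱼ≡gⱼ))

≤-updateAt-suc : ∀ {n} (y : Fin n → ℕ) v u → y u ≤ updateAt y v suc u
≤-updateAt-suc y v u with u ≟ v
... | yes refl = ≤-trans (n≤1+n (y v)) (≤-reflexive (sym (updateAt-updates v y)))
... | no  u≢v  = ≤-reflexive (sym (updateAt-minimal u v y u≢v))

∑-updateAt-suc : ∀ {n} (y : Fin n → ℕ) v → sum (updateAt y v suc) ≡ suc (sum y)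
∑-updateAt-suc y v = +-cancelʳ-≡ (y v) _ _ (begin
  sum (updateAt y v suc) + y v  ≡⟨ ∑-exchange v (λ u u≢v → updateAt-minimal u v y u≢v) ⟩
  sum y + updateAt y v suc v    ≡⟨ cong (sum y +_) (updateAt-updates v y) ⟩
  sum y + suc (y v)             ≡⟨ +-suc (sum y) (y v) ⟩
  suc (sum y) + y v             ∎)
  where open ≡-Reasoning

𝟙 : ∀ {a} {A : Set a} → Dec A → ℕ
𝟙 (yes _) = 1
𝟙 (no _)  = 0

𝟙-×-dec : ∀ {a b} {A : Set a} {B : Set b} (a? : Dec A) (b? : Dec B) → 𝟙 (a? ×-dec b?) ≡ 𝟙 a? * 𝟙 b?
𝟙-×-dec (yes _) (yes _) = refl
𝟙-×-dec (yes _) (no _)  = refl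
𝟙-×-dec (no _)  _       = refl

𝟙-≟-comm : ∀ (x y : ℕ) → 𝟙 (x ≟ℕ y) ≡ 𝟙 (y ≟ℕ x)
𝟙-≟-comm x y with x ≟ℕ y | y ≟ℕ x
... | yes _   | yes _   = refl
... | no  _   | no  _   = refl
... | yes x≡y | no  y≢x = contradiction (sym x≡y) y≢x
... | no  x≢y | yes y≡x = contradiction (sym y≡x) x≢y

length-filter-tabulate : ∀ {a p} {A : Set a} {P : A → Set p} (P? : Decidable P) {n} (f : Fin n → A) →
  length (filter P? (tabulate f)) ≡ ∑[ i < n ] 𝟙 (P? (f i))
length-filter-tabulate P? {zero}  f = refl
length-filter-tabulate P? {suc n} f with P? (f zero)
... | yes _ = cong suc (length-filter-tabulate P? (f ∘ suc))
... | no  _ = length-filter-tabulate P? (f ∘ suc)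

length-filter-allFin : ∀ {p n} {P : Fin n → Set p} (P? : Decidable P) →
  length (filter P? (allFin n)) ≡ ∑[ i < n ] 𝟙 (P? i)
length-filter-allFin P? = length-filter-tabulate P? id

∑-𝟙-≟-injective : ∀ {m} {ℓ : Fin m → ℕ} → Injective _≡_ _≡_ ℓ → ∀ x → ∑[ i < m ] 𝟙 (ℓ i ≟ℕ x) ≤ 1
∑-𝟙-≟-injective {zero}      inj x = z≤n
∑-𝟙-≟-injective {suc m} {ℓ} inj x with ℓ zero ≟ℕ x
... | yes ℓ₀≡x = s≤s (≤-reflexive (trans (sum-cong-≗ others-miss) (sum-replicate-zero m)))
  where
  others-miss : ∀ i → 𝟙 (ℓ (suc i) ≟ℕ x) ≡ 0
  others-miss i with ℓ (suc i) ≟ℕ x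
  ... | yes ℓᵢ≡x = contradiction (inj (trans ℓᵢ≡x (sym ℓ₀≡x))) λ ()
  ... | no  _    = refl
... | no  _    = ∑-𝟙-≟-injective (suc-injective ∘ inj) x

∑-count-injective-≤ : ∀ {m n} {ℓ : Fin m → ℕ} → Injective _≡_ _≡_ ℓ → ∀ (h key : Fin n → ℕ) →
  ∑[ i < m ] ∑[ w < n ] (h w * 𝟙 (ℓ i ≟ℕ key w)) ≤ sum h
∑-count-injective-≤ {m} {n} {ℓ} inj h key = begin
  ∑[ i < m ] ∑[ w < n ] (h w * 𝟙 (ℓ i ≟ℕ key w))  ≡⟨ ∑-comm (λ i w → h w * 𝟙 (ℓ i ≟ℕ key w)) ⟩
  ∑[ w < n ] ∑[ i < m ] (h w * 𝟙 (ℓ i ≟ℕ key w))  ≡⟨ sum-cong-≗ (λ w → *-distribˡ-sum (h w) (λ i → 𝟙 (ℓ i ≟ℕ key w))) ⟨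
  ∑[ w < n ] (h w * ∑[ i < m ] 𝟙 (ℓ i ≟ℕ key w))  ≤⟨ ∑-mono-≤ (λ w → *-monoʳ-≤ (h w) (∑-𝟙-≟-injective inj (key w))) ⟩
  ∑[ w < n ] (h w * 1)                             ≡⟨ sum-cong-≗ (λ w → *-identityʳ (h w)) ⟩
  sum h                                            ∎
  where open ≤-Reasoning

lookup-injective : ∀ {xs : List ℕ} → Unique xs → Injective _≡_ _≡_ (lookup xs)
lookup-injective {_ ∷ _}  _           {zero}  {zero}  _     = refl
lookup-injective {_ ∷ xs} (x∉xs ∷ _)  {zero}  {suc j} x≡xⱼ  = contradiction x≡xⱼ (All.lookup x∉xs (∈-lookup {xs = xs} j))
lookup-injective {_ ∷ xs} (x∉xs ∷ _)  {suc i} {zero}  xᵢ≡x  = contradiction (sym xᵢ≡x) (All.lookup x∉xs (∈-lookup {xs = xs} i))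
lookup-injective {_ ∷ _}  (_ ∷ uniq)  {suc i} {suc j} xᵢ≡xⱼ = cong suc (lookup-injective uniq xᵢ≡xⱼ)

length≡suc⇒∃∈ : ∀ {A : Set} {m} (xs : List A) → length xs ≡ suc m → ∃ (_∈ xs)
length≡suc⇒∃∈ (x ∷ _) _ = x , here refl

module _ {n} (a : Fin n → Fin n → ℕ) where

  conflicts : (Fin n → ℕ) → ℕ
  conflicts c = ∑[ u < n ] ∑[ w < n ] (a u w * 𝟙 (c w ≟ℕ c u))

  -- The terms of conflicts that involve v, when v has colour b and every other vertex u has colour c u.
  localCost : (Fin n → ℕ) → Fin n → ℕ → ℕ
  localCost c v b = ∑[ u < n ] (a u v * 𝟙 (b ≟ℕ c u)) + ∑[ w < n ] (a v w * 𝟙 (c w ≟ℕ b))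

  conflicts-recolour : ∀ {c c′ : Fin n → ℕ} v → a v v ≡ 0 → (∀ w → w ≢ v → c′ w ≡ c w) →
    conflicts c′ + localCost c v (c v) ≡ conflicts c + localCost c v (c′ v)
  conflicts-recolour {c} {c′} v aᵥᵥ≡0 agree = begin
    conflicts c′ + (in-cost (c v) + out-cost c (c v))
      ≡⟨ +-assoc (conflicts c′) _ _ ⟨
    conflicts c′ + in-cost (c v) + out-cost c (c v)
      ≡⟨ cong₂ _+_ (∑-distrib-+ (sum ∘ row c′) (in-term (c v))) (drop-loop c _) ⟨
    sum F + G v
      ≡⟨ ∑-exchange v F≡G ⟩
    sum G + F v
      ≡⟨ cong₂ _+_ (∑-distrib-+ (sum ∘ row c) (in-term (c′ v))) (drop-loop c′ _) ⟩
    conflicts c + in-cost (c′ v) + out-cost c′ (c′ v)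
      ≡⟨ cong (conflicts c + in-cost (c′ v) +_) out-cost-c′ ⟩
    conflicts c + in-cost (c′ v) + out-cost c (c′ v)
      ≡⟨ +-assoc (conflicts c) _ _ ⟩
    conflicts c + (in-cost (c′ v) + out-cost c (c′ v))
      ∎
    where
    open ≡-Reasoning
    row : (Fin n → ℕ) → Fin n → Fin n → ℕ
    row d u w = a u w * 𝟙 (d w ≟ℕ d u)
    in-term : ℕ → Fin n → ℕ
    in-term b u = a u v * 𝟙 (b ≟ℕ c u)
    in-cost : ℕ → ℕ
    in-cost b = sum (in-term b)
    out-cost : (Fin n → ℕ) → ℕ → ℕ
    out-cost d b = ∑[ w < n ] (a v w * 𝟙 (d w ≟ℕ b))
    -- Rows of c′ and of c, each completed by the column-v entry of the other colouring.
    F G : Fin n → ℕ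
    F u = sum (row c′ u) + in-term (c v) u
    G u = sum (row c u) + in-term (c′ v) u
    F≡G : ∀ u → u ≢ v → F u ≡ G u
    F≡G u u≢v rewrite agree u u≢v =
      ∑-exchange v λ w w≢v → cong (λ x → a u w * 𝟙 (x ≟ℕ c u)) (agree w w≢v)
    drop-loop : ∀ d x → sum (row d v) + a v v * x ≡ out-cost d (d v)
    drop-loop d x rewrite aᵥᵥ≡0 = +-identityʳ _
    out-cost-c′ : out-cost c′ (c′ v) ≡ out-cost c (c′ v)
    out-cost-c′ = ∑-cong-off v (λ w w≢v → cong (λ x → a v w * 𝟙 (x ≟ℕ c′ v)) (agree w w≢v))
                               (trans (cong (_* _) aᵥᵥ≡0) (cong (_* _) (sym aᵥᵥ≡0)))

  ∑-localCost-≤ : ∀ {m} {ℓ : Fin m → ℕ} → Injective _≡_ _≡_ ℓ → ∀ c v →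
    ∑[ i < m ] localCost c v (ℓ i) ≤ ∑[ u < n ] a u v + ∑[ w < n ] a v w
  ∑-localCost-≤ {m} {ℓ} inj c v = begin
    ∑[ i < m ] localCost c v (ℓ i)
      ≡⟨ ∑-distrib-+ (λ i → ∑[ u < n ] (a u v * 𝟙 (ℓ i ≟ℕ c u))) (λ i → ∑[ w < n ] (a v w * 𝟙 (c w ≟ℕ ℓ i))) ⟩
    ∑[ i < m ] ∑[ u < n ] (a u v * 𝟙 (ℓ i ≟ℕ c u)) + ∑[ i < m ] ∑[ w < n ] (a v w * 𝟙 (c w ≟ℕ ℓ i))
      ≤⟨ +-mono-≤ (∑-count-injective-≤ inj (λ u → a u v) c)
                  (subst (_≤ _) (sum-cong-≗ λ i → sum-cong-≗ λ w → cong (a v w *_) (𝟙-≟-comm (ℓ i) (c w)))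
                         (∑-count-injective-≤ inj (a v) c)) ⟩
    ∑[ u < n ] a u v + ∑[ w < n ] a v w
      ∎
    where open ≤-Reasoning

module _ {n} (D : Digraph n) where

  arc : Fin n → Fin n → ℕ
  arc u w = 𝟙 (arc? D u w)

  *-arc-loop≡0 : ∀ x v → x * arc v v ≡ 0
  *-arc-loop≡0 x v with arc? D v v
  ... | yes v→v = contradiction v→v (loopless D v)
  ... | no  _   = *-zeroʳ x

  outdeg≡∑arc : ∀ v → outdeg D v ≡ ∑[ w < n ] arc v w
  outdeg≡∑arc v = length-filter-allFin (arc? D v)

  sameOut≡∑arc : ∀ c v → sameOut D c v ≡ ∑[ w < n ] (arc v w * 𝟙 (c w ≟ℕ c v))
  sameOut≡∑arc c v = trans (length-filter-allFin (λ w → arc? D v w ×-dec (c w ≟ℕ c v)))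
                           (sum-cong-≗ λ w → 𝟙-×-dec (arc? D v w) (c w ≟ℕ c v))

  inflow : (Fin n → ℕ) → Fin n → ℕ
  inflow y v = ∑[ u < n ] (y u * arc u v)

  ∑-inflow : ∀ y → ∑[ v < n ] inflow y v ≡ ∑[ u < n ] (outdeg D u * y u)
  ∑-inflow y = begin
    ∑[ v < n ] ∑[ u < n ] (y u * arc u v)  ≡⟨ ∑-comm (λ v u → y u * arc u v) ⟩
    ∑[ u < n ] ∑[ v < n ] (y u * arc u v)  ≡⟨ sum-cong-≗ (λ u → *-distribˡ-sum (y u) (arc u)) ⟨
    ∑[ u < n ] (y u * ∑[ v < n ] arc u v)  ≡⟨ sum-cong-≗ (λ u → trans (*-comm (outdeg D u) (y u)) (cong (y u *_) (outdeg≡∑arc u))) ⟨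
    ∑[ u < n ] (outdeg D u * y u)          ∎
    where open ≡-Reasoning

  inflow-mono : ∀ {y y′} → (∀ u → y u ≤ y′ u) → ∀ v → inflow y v ≤ inflow y′ v
  inflow-mono y≤y′ v = ∑-mono-≤ (λ u → *-monoˡ-≤ (arc u v) (y≤y′ u))

  inflow-cong-off : ∀ {y y′} v → (∀ u → u ≢ v → y u ≡ y′ u) → inflow y v ≡ inflow y′ v
  inflow-cong-off {y} {y′} v y≡y′ = ∑-cong-off v (λ u u≢v → cong (_* arc u v) (y≡y′ u u≢v))
    (trans (*-arc-loop≡0 (y v) v) (sym (*-arc-loop≡0 (y′ v) v)))

  Balanced : (Fin n → ℕ) → Set
  Balanced y = ∀ v → inflow y v < suc (outdeg D v) * y v

  -- Equivalently y v ≤ 1 + ⌊inflow y v / (d⁺ v + 1)⌋.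
  Subbalanced : (Fin n → ℕ) → Set
  Subbalanced y = ∀ v → suc (outdeg D v) * y v ≤ suc (outdeg D v) + inflow y v

  subbalanced⇒∑≤ : ∀ {y} → Subbalanced y → sum y ≤ ∑[ v < n ] suc (outdeg D v)
  subbalanced⇒∑≤ {y} sub = +-cancelʳ-≤ (∑[ u < n ] (outdeg D u * y u)) _ _ (begin
    sum y + ∑[ u < n ] (outdeg D u * y u)                        ≡⟨ ∑-distrib-+ y (λ u → outdeg D u * y u) ⟨
    ∑[ v < n ] (suc (outdeg D v) * y v)                          ≤⟨ ∑-mono-≤ sub ⟩
    ∑[ v < n ] (suc (outdeg D v) + inflow y v)                   ≡⟨ ∑-distrib-+ (λ v → suc (outdeg D v)) (inflow y) ⟩
    ∑[ v < n ] suc (outdeg D v) + ∑[ v < n ] inflow y v          ≡⟨ cong (∑[ v < n ] suc (outdeg D v) +_) (∑-inflow y) ⟩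
    ∑[ v < n ] suc (outdeg D v) + ∑[ u < n ] (outdeg D u * y u)  ∎)
    where open ≤-Reasoning

  raise-subbalanced : ∀ {y} → Subbalanced y → ∀ v → ¬ inflow y v < suc (outdeg D v) * y v →
    Subbalanced (updateAt y v suc)
  raise-subbalanced {y} sub v unbalanced w with w ≟ v
  ... | yes refl = begin
    suc (outdeg D v) * updateAt y v suc v           ≡⟨ cong (suc (outdeg D v) *_) (updateAt-updates v y) ⟩
    suc (outdeg D v) * suc (y v)                    ≡⟨ *-suc (suc (outdeg D v)) (y v) ⟩
    suc (outdeg D v) + suc (outdeg D v) * y v       ≤⟨ +-monoʳ-≤ (suc (outdeg D v)) (≮⇒≥ unbalanced) ⟩
    suc (outdeg D v) + inflow y v                   ≡⟨ cong (suc (outdeg D v) +_) (inflow-cong-off v λ u u≢v → sym (updateAt-minimal u v y u≢v)) ⟩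
    suc (outdeg D v) + inflow (updateAt y v suc) v  ∎
    where open ≤-Reasoning
  ... | no  w≢v = begin
    suc (outdeg D w) * updateAt y v suc w           ≡⟨ cong (suc (outdeg D w) *_) (updateAt-minimal w v y w≢v) ⟩
    suc (outdeg D w) * y w                          ≤⟨ sub w ⟩
    suc (outdeg D w) + inflow y w                   ≤⟨ +-monoʳ-≤ (suc (outdeg D w)) (inflow-mono (≤-updateAt-suc y v) w) ⟩
    suc (outdeg D w) + inflow (updateAt y v suc) w  ∎
    where open ≤-Reasoning

  balanced-weights : Σ (Fin n → ℕ) Balanced
  balanced-weights =
    let y , _ , balanced = find-by-descent Subbalanced Balanced (λ y → bound ∸ sum y) balanced? raise
                                           (λ _ → 0) (λ v → ≤-trans (≤-reflexive (*-zeroʳ (suc (outdeg D v)))) z≤n)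
    in y , balanced
    where
    bound : ℕ
    bound = ∑[ v < n ] suc (outdeg D v)
    balanced? : Decidable Balanced
    balanced? y = all? (λ v → inflow y v <? suc (outdeg D v) * y v)
    raise : ∀ y → Subbalanced y → ¬ Balanced y →
      Σ (Fin n → ℕ) λ y′ → Subbalanced y′ × bound ∸ sum y′ < bound ∸ sum y
    raise y sub unbalanced
      with v , v-unbalanced ← ¬∀⟶∃¬ n _ (λ v → inflow y v <? suc (outdeg D v) * y v) unbalanced
      = updateAt y v suc , sub′ , ∸-monoʳ-< (≤-reflexive (sym (∑-updateAt-suc y v))) (subbalanced⇒∑≤ sub′)
      where
      sub′ : Subbalanced (updateAt y v suc)
      sub′ = raise-subbalanced sub v v-unbalanced

  module _ {y : Fin n → ℕ} (balanced : Balanced y) {k} {L : Fin n → List ℕ}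
           (isList : IsListAssignment (2 * k) L) where

    weightedArc : Fin n → Fin n → ℕ
    weightedArc u w = y u * arc u w

    sameOut≤localCost : ∀ c v → y v * sameOut D c v ≤ localCost weightedArc c v (c v)
    sameOut≤localCost c v = begin
      y v * sameOut D c v                             ≡⟨ cong (y v *_) (sameOut≡∑arc c v) ⟩
      y v * ∑[ w < n ] (arc v w * 𝟙 (c w ≟ℕ c v))     ≡⟨ *-distribˡ-sum (y v) (λ w → arc v w * 𝟙 (c w ≟ℕ c v)) ⟩
      ∑[ w < n ] (y v * (arc v w * 𝟙 (c w ≟ℕ c v)))   ≡⟨ sum-cong-≗ (λ w → *-assoc (y v) (arc v w) _) ⟨
      ∑[ w < n ] (weightedArc v w * 𝟙 (c w ≟ℕ c v))  ≤⟨ m≤n+m _ _ ⟩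
      localCost weightedArc c v (c v)                 ∎
      where open ≤-Reasoning

    ∑-localCost< : ∀ c v → outdeg D v < k * sameOut D c v →
      ∑[ i < length (L v) ] localCost weightedArc c v (lookup (L v) i) < length (L v) * localCost weightedArc c v (c v)
    ∑-localCost< c v overloaded = begin-strict
      ∑[ i < length (L v) ] localCost weightedArc c v (lookup (L v) i)
        ≤⟨ ∑-localCost-≤ weightedArc (lookup-injective (proj₁ (isList v))) c v ⟩
      inflow y v + ∑[ w < n ] (y v * arc v w)
        ≡⟨ cong (inflow y v +_) (trans (cong (y v *_) (outdeg≡∑arc v)) (*-distribˡ-sum (y v) (arc v))) ⟨
      inflow y v + y v * d
        <⟨ +-monoˡ-< (y v * d) (balanced v) ⟩
      suc d * y v + y v * d
        ≤⟨ +-monoʳ-≤ (suc d * y v) (≤-trans (≤-reflexive (*-comm (y v) d)) (*-monoˡ-≤ (y v) (n≤1+n d))) ⟩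
      suc d * y v + suc d * y v
        ≤⟨ +-mono-≤ (*-monoˡ-≤ (y v) overloaded) (*-monoˡ-≤ (y v) overloaded) ⟩
      k * s * y v + k * s * y v
        ≡⟨ double k s (y v) ⟩
      2 * k * (y v * s)
        ≤⟨ *-monoʳ-≤ (2 * k) (sameOut≤localCost c v) ⟩
      2 * k * localCost weightedArc c v (c v)
        ≡⟨ cong (_* localCost weightedArc c v (c v)) (proj₂ (isList v)) ⟨
      length (L v) * localCost weightedArc c v (c v)
        ∎
      where
      open ≤-Reasoning
      d s : ℕ
      d = outdeg D v
      s = sameOut D c v
      double : ∀ k s y → k * s * y + k * s * y ≡ 2 * k * (y * s)
      double = solve-∀

    recolouring-improves : ∀ c → (∀ v → c v ∈ L v) → ¬ IsMajorityColouring k D c →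
      Σ (Colouring n) λ c′ → (∀ v → c′ v ∈ L v) × conflicts weightedArc c′ < conflicts weightedArc c
    recolouring-improves c c∈L ¬majority
      with v , v-overloaded ← ¬∀⟶∃¬ n _ (λ v → k * sameOut D c v ≤? outdeg D v) ¬majority
      with i , cheaper ← ∑<*⇒∃< _ _ (∑-localCost< c v (≰⇒> v-overloaded))
      = c′ , c′∈L , fewer-conflicts
      where
      b : ℕ
      b = lookup (L v) i
      c′ : Colouring n
      c′ = updateAt c v (λ _ → b)
      cost : ℕ → ℕ
      cost = localCost weightedArc c v
      c′≡c : ∀ w → w ≢ v → c′ w ≡ c w
      c′≡c w w≢v = updateAt-minimal w v c w≢v
      c′∈L : ∀ w → c′ w ∈ L w
      c′∈L w with w ≟ v
      ... | yes refl = subst (_∈ L v) (sym (updateAt-updates v c)) (∈-lookup {xs = L v} i)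
      ... | no  w≢v  = subst (_∈ L w) (sym (c′≡c w w≢v)) (c∈L w)
      fewer-conflicts : conflicts weightedArc c′ < conflicts weightedArc c
      fewer-conflicts = +-cancelʳ-< (cost (c v)) _ _ (begin-strict
        conflicts weightedArc c′ + cost (c v)  ≡⟨ conflicts-recolour weightedArc v (*-arc-loop≡0 (y v) v) c′≡c ⟩
        conflicts weightedArc c + cost (c′ v)  ≡⟨ cong (λ x → conflicts weightedArc c + cost x) (updateAt-updates v c) ⟩
        conflicts weightedArc c + cost b       <⟨ +-monoʳ-< (conflicts weightedArc c) cheaper ⟩
        conflicts weightedArc c + cost (c v)   ∎)
        where open ≤-Reasoning

    majority-colouring : ∀ c → (∀ v → c v ∈ L v) →
      Σ (Colouring n) λ c → (∀ v → c v ∈ L v) × IsMajorityColouring k D c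
    majority-colouring = find-by-descent (λ c → ∀ v → c v ∈ L v) (IsMajorityColouring k D) (conflicts weightedArc)
      (λ c → all? λ v → k * sameOut D c v ≤? outdeg D v) recolouring-improves

majority-choosable : ∀ {k} → 0 < k → ∀ {n} (D : Digraph n) → MajorityChoosable k (2 * k) D
majority-choosable {suc _} _ D L isList =
  majority-colouring D (proj₂ (balanced-weights D)) isList (proj₁ ∘ some-colour) (proj₂ ∘ some-colour)
  where
  some-colour : ∀ v → ∃ (_∈ L v)
  some-colour v = length≡suc⇒∃∈ (L v) (proj₂ (isList v))

theorem4 : ∀ (k : ℕ) → 2 ≤ k → ∀ (n : ℕ) (D : Digraph n) → MajorityChoosable k (2 * k) D
theorem4 _ 2≤k _ = majority-choosable (<-trans z<s 2≤k)
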